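{- Let $\mathcal{F}$ be a proper family of subsets of $V$ all of whose cores are singletons, let $T$ be its set of terminals, and let $S\subseteq T$. If $S\notin\mathcal{F}$, then $\mathcal{F}=\mathcal{F}_S\cup\mathcal{F}_{T\setminus S}$.
   Context: $\mathcal{F}$ is proper if it is disjointness-compliable ($A'\subseteq A\in\mathcal{F}$ implies $A'\in\mathcal{F}$ or $A\setminus A'\in\mathcal{F}$) and symmetric ($A\in\mathcal{F}$ implies $V\setminus A\in\mathcal{F}$). A core is an inclusion-minimal member of $\mathcal{F}$; when all cores are singletons, a terminal is a node $t$ with $\{t\}$ a core, and $T$ is the set of terminals. A set $A$ divides a set $S$ if $S\cap A$ and $S\setminus A$ are both non-empty. For $S\subseteq T$, $\mathcal{F}_S=\{A\in\mathcal{F}: A \text{ divides } S\}$. -}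

module Defs where

open import Data.Bool using (Bool; true)
open import Data.Nat using (ℕ)
open import Data.Fin using (Fin)
open import Data.Fin.Subset using (Subset; _∈_; _∉_; _⊆_; _─_; ∁; ⁅_⁆)
open import Data.Product using (Σ; ∃; _×_)
open import Data.Sum using (_⊎_)
open import Relation.Binary.PropositionalEquality using (_≡_)

-- A family of subsets of the finite ground set V = Fin n,
-- given by its (decidable) membership function.
Family : ℕ → Set
Family n = Subset n → Bool

_∈F_ : ∀ {n} → Subset n → Family n → Set
A ∈F 𝓕 = 𝓕 A ≡ true

DisjointnessCompliable : ∀ {n} → Family n → Set
DisjointnessCompliable 𝓕 =
  ∀ A A' → A' ⊆ A → A ∈F 𝓕 → (A' ∈F 𝓕) ⊎ ((A ─ A') ∈F 𝓕)

Symmetric : ∀ {n} → Family n → Set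
Symmetric 𝓕 = ∀ A → A ∈F 𝓕 → ∁ A ∈F 𝓕

Proper : ∀ {n} → Family n → Set
Proper 𝓕 = DisjointnessCompliable 𝓕 × Symmetric 𝓕

IsCore : ∀ {n} → Family n → Subset n → Set
IsCore 𝓕 A = A ∈F 𝓕 × (∀ B → B ∈F 𝓕 → B ⊆ A → B ≡ A)

AllCoresSingletons : ∀ {n} → Family n → Set
AllCoresSingletons {n} 𝓕 = ∀ A → IsCore 𝓕 A → ∃ λ (t : Fin n) → A ≡ ⁅ t ⁆

IsTerminal : ∀ {n} → Family n → Fin n → Set
IsTerminal 𝓕 t = IsCore 𝓕 ⁅ t ⁆

Divides : ∀ {n} → Subset n → (Fin n → Set) → Set
Divides {n} A P = (∃ λ (x : Fin n) → P x × x ∈ A) × (∃ λ (x : Fin n) → P x × x ∉ A)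

-- membership in F_P = { A ∈ F : A divides P }
_∈F[_] : ∀ {n} → Subset n → Family n → (Fin n → Set) → Set
(A ∈F[ 𝓕 ]) P = A ∈F 𝓕 × Divides A P

InSet : ∀ {n} → Subset n → Fin n → Set
InSet S x = x ∈ S

TerminalsMinus : ∀ {n} → Family n → Subset n → Fin n → Set
TerminalsMinus 𝓕 S x = IsTerminal 𝓕 x × x ∉ S

-- Let A ∈ F. If A does not divide S, then S lies inside A or inside its
-- complement, and by symmetry we may take it to be a member B ⊇ S of F.
-- Since S ∉ F, disjointness-compliance puts B ∖ S in F, so B ∖ S contains
-- a core, i.e. a terminal outside S; and V ∖ B ∈ F contains a terminal
-- that is outside B, hence outside S. So B, and with it A, divides T ∖ S.
module Submission where

open import Defs
open import Data.Nat using (ℕ)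
open import Data.Bool using (true)
open import Data.Bool.Properties using () renaming (_≟_ to _≟ᵇ_)
open import Data.Fin using (Fin)
open import Data.Fin.Properties using (any?)
open import Data.Fin.Subset using (Subset; _∈_; _∉_; _⊆_; _⊂_; _─_; ∁; inside; outside)
open import Data.Fin.Subset.Induction using (Acc; acc; ⊂-wellFounded)
open import Data.Fin.Subset.Properties
  using (anySubset?; _∈?_; _⊂?_; ⊆-antisym; ⊆-trans; p─q⊆p; x∈⁅x⁆; x∉p⇒x∈∁p; x∈∁p⇒x∉p; x∉∁p⇒x∈p)
open import Data.Vec.Base using (_∷_; here; there)
open import Data.Product using (_×_; _,_; ∃; proj₁)
open import Data.Sum using (_⊎_; inj₁; inj₂; [_,_])
open import Function using (id; _∘_)
open import Relation.Nullary using (¬_; yes; no; ¬?; contradiction)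
open import Relation.Nullary.Decidable using (_×-dec_; decidable-stable)
open import Relation.Unary using (Pred; Decidable)
open import Relation.Binary.PropositionalEquality using (_≡_; refl)

x∈p─q⇒x∉q : ∀ {n} (p q : Subset n) {x} → x ∈ p ─ q → x ∉ q
x∈p─q⇒x∉q (inside ∷ p) (outside ∷ q) here         ()
x∈p─q⇒x∉q (_ ∷ p)      (_ ∷ q)       (there x∈p─q) (there x∈q) = x∈p─q⇒x∉q p q x∈p─q x∈q

module _ {n : ℕ} {ℓ} {P : Pred (Subset n) ℓ} (P? : Decidable P) where

  ⊆-minimal : ∀ {A} → P A → ∃ λ B → B ⊆ A × P B × (∀ C → P C → C ⊆ B → C ≡ B)
  ⊆-minimal {A} = go (⊂-wellFounded A)
    where
    go : ∀ {A} → Acc _⊂_ A → P A → ∃ λ B → B ⊆ A × P B × (∀ C → P C → C ⊆ B → C ≡ B)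
    go {A} (acc smaller) PA with anySubset? (λ C → P? C ×-dec C ⊂? A)
    ... | yes (C , PC , C⊂A) with go (smaller C⊂A) PC
    ...   | B , B⊆C , PB , minimal = B , ⊆-trans B⊆C (proj₁ C⊂A) , PB , minimal
    go {A} _ PA | no ∄C⊂A = A , id , PA , minimal
      where
      minimal : ∀ C → P C → C ⊆ A → C ≡ A
      minimal C PC C⊆A = ⊆-antisym C⊆A λ {x} x∈A →
        decidable-stable (x ∈? C) (λ x∉C → ∄C⊂A (C , PC , C⊆A , x , x∈A , x∉C))

module _ {n : ℕ} (𝓕 : Family n) where

  core-⊆ : ∀ {A} → A ∈F 𝓕 → ∃ λ C → C ⊆ A × IsCore 𝓕 C
  core-⊆ = ⊆-minimal (λ B → 𝓕 B ≟ᵇ true)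

  terminal-∈ : AllCoresSingletons 𝓕 → ∀ {A} → A ∈F 𝓕 → ∃ λ t → IsTerminal 𝓕 t × t ∈ A
  terminal-∈ singletonCores A∈𝓕 with core-⊆ A∈𝓕
  ... | C , C⊆A , C-core with singletonCores C C-core
  ...   | t , refl = t , C-core , C⊆A (x∈⁅x⁆ t)

  ⊇-nonmember⇒divides-T─S : DisjointnessCompliable 𝓕 → Symmetric 𝓕 → AllCoresSingletons 𝓕 →
    ∀ {S B} → ¬ (S ∈F 𝓕) → S ⊆ B → B ∈F 𝓕 → Divides B (TerminalsMinus 𝓕 S)
  ⊇-nonmember⇒divides-T─S compliable symmetric singletonCores {S} {B} S∉𝓕 S⊆B B∈𝓕 =
    terminalInside , terminalOutside
    where
    B─S∈𝓕 : (B ─ S) ∈F 𝓕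
    B─S∈𝓕 = [ (λ S∈𝓕 → contradiction S∈𝓕 S∉𝓕) , id ] (compliable B S S⊆B B∈𝓕)

    terminalInside : ∃ λ t → TerminalsMinus 𝓕 S t × t ∈ B
    terminalInside with terminal-∈ singletonCores B─S∈𝓕
    ... | t , t-terminal , t∈B─S = t , (t-terminal , x∈p─q⇒x∉q B S t∈B─S) , p─q⊆p B S t∈B─S

    terminalOutside : ∃ λ t → TerminalsMinus 𝓕 S t × t ∉ B
    terminalOutside with terminal-∈ singletonCores (symmetric B B∈𝓕)
    ... | t , t-terminal , t∈∁B = t , (t-terminal , x∈∁p⇒x∉p t∈∁B ∘ S⊆B) , x∈∁p⇒x∉p t∈∁B

Divides-∁⁻ : ∀ {n} {A : Subset n} {P : Fin n → Set} → Divides (∁ A) P → Divides A P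
Divides-∁⁻ ((x , Px , x∈∁A) , (y , Py , y∉∁A)) = (y , Py , x∉∁p⇒x∈p y∉∁A) , (x , Px , x∈∁p⇒x∉p x∈∁A)

divides⊎⊆⊎⊆∁ : ∀ {n} (A S : Subset n) → Divides A (InSet S) ⊎ S ⊆ A ⊎ S ⊆ ∁ A
divides⊎⊆⊎⊆∁ A S with any? (λ x → x ∈? S ×-dec x ∈? A) | any? (λ x → x ∈? S ×-dec ¬? (x ∈? A))
... | yes S∩A | yes S─A = inj₁ (S∩A , S─A)
... | _       | no ∄S─A =
  inj₂ (inj₁ λ {x} x∈S → decidable-stable (x ∈? A) (λ x∉A → ∄S─A (x , x∈S , x∉A)))
... | no ∄S∩A | _ = inj₂ (inj₂ λ {x} x∈S → x∉p⇒x∈∁p (λ x∈A → ∄S∩A (x , x∈S , x∈A)))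

lemma22 : (n : ℕ) (𝓕 : Family n) → Proper 𝓕 → AllCoresSingletons 𝓕 →
    (S : Subset n) → (∀ t → t ∈ S → IsTerminal 𝓕 t) → ¬ (S ∈F 𝓕) →
    ∀ (A : Subset n) →
    ((A ∈F 𝓕) → ((A ∈F[ 𝓕 ]) (InSet S) ⊎ (A ∈F[ 𝓕 ]) (TerminalsMinus 𝓕 S)))
    × (((A ∈F[ 𝓕 ]) (InSet S) ⊎ (A ∈F[ 𝓕 ]) (TerminalsMinus 𝓕 S)) → (A ∈F 𝓕))
lemma22 n 𝓕 (compliable , symmetric) singletonCores S _ S∉𝓕 A = split , [ proj₁ , proj₁ ]
  where
  divides-T─S : ∀ {B} → S ⊆ B → B ∈F 𝓕 → Divides B (TerminalsMinus 𝓕 S)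
  divides-T─S = ⊇-nonmember⇒divides-T─S 𝓕 compliable symmetric singletonCores S∉𝓕

  split : A ∈F 𝓕 → (A ∈F[ 𝓕 ]) (InSet S) ⊎ (A ∈F[ 𝓕 ]) (TerminalsMinus 𝓕 S)
  split A∈𝓕 with divides⊎⊆⊎⊆∁ A S
  ... | inj₁ A-divides-S = inj₁ (A∈𝓕 , A-divides-S)
  ... | inj₂ (inj₁ S⊆A)  = inj₂ (A∈𝓕 , divides-T─S S⊆A A∈𝓕)
  ... | inj₂ (inj₂ S⊆∁A) = inj₂ (A∈𝓕 , Divides-∁⁻ (divides-T─S S⊆∁A (symmetric A A∈𝓕)))
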